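{- For every integer $n\ge 3$, the $(3,2)$ broadcast domination number of the $3\times n$ grid graph satisfies \[\gamma_{3,2}(G_{3,n})=\left\lceil \frac{n+1}{2}\right\rceil .\]
   Context: For positive integers $m,n$, $G_{m,n}$ denotes the $m\times n$ grid graph (the Cartesian product of a path on $m$ vertices and a path on $n$ vertices). For a graph $G=(V,E)$ with shortest-path distance $d$ and integers $1\le r\le t$, the reception strength of $u\in V$ with respect to $S\subseteq V$ is $r(u)=\sum_{v\in S,\ d(u,v)<t}\bigl(t-d(u,v)\bigr)$. A set $S\subseteq V$ is a $(t,r)$ broadcast dominating set if $r(u)\ge r$ for every $u\in V$. The $(t,r)$ broadcast domination number $\gamma_{t,r}(G)$ is the minimum cardinality of a $(t,r)$ broadcast dominating set of $G$. -}

module Defs where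

open import Data.Nat using (ℕ; zero; suc; _+_; _∸_; _<_; _≤_; _<ᵇ_; _≥_)
open import Data.Nat.Properties using ()
open import Data.Bool using (if_then_else_)
open import Data.Fin using (Fin; toℕ)
open import Data.Product using (_×_; _,_; Σ; proj₁; proj₂)
open import Data.List using (List; length; map)
open import Data.Nat.ListAction using (sum)
open import Data.List.Relation.Unary.Unique.Propositional using (Unique)

∣_-_∣ : ℕ → ℕ → ℕ
∣ a - b ∣ = (a ∸ b) + (b ∸ a)

Vertex : ℕ → ℕ → Set
Vertex m n = Fin m × Fin n

-- shortest-path distance in the grid graph P_m □ P_n
-- (distance in a Cartesian product of paths = sum of the coordinate distances)
dist : ∀ {m n} → Vertex m n → Vertex m n → ℕ
dist (i , j) (i' , j') = ∣ toℕ i - toℕ i' ∣ + ∣ toℕ j - toℕ j' ∣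

contrib : ∀ {m n} → ℕ → Vertex m n → Vertex m n → ℕ
contrib t u v = if dist u v <ᵇ t then t ∸ dist u v else 0

reception : ∀ {m n} → ℕ → List (Vertex m n) → Vertex m n → ℕ
reception t S u = sum (map (contrib t u) S)

IsBroadcastDominating : ∀ {m n} → ℕ → ℕ → List (Vertex m n) → Set
IsBroadcastDominating {m} {n} t r S =
  Unique S × ((u : Vertex m n) → r ≤ reception t S u)

BroadcastDominationNumber : ℕ → ℕ → ℕ → ℕ → ℕ → Set
BroadcastDominationNumber t r m n k =
  Σ (List (Vertex m n)) (λ S → IsBroadcastDominating t r S × length S ≡ k)
  × ((S : List (Vertex m n)) → IsBroadcastDominating t r S → k ≤ length S)
  where open import Relation.Binary.PropositionalEquality using (_≡_)

-- Reception with t = 3 reaches at most two columns to either side, so a set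
-- dominates G_{3,n} exactly when every window of five consecutive columns, the
-- grid being padded with two empty columns on each side, gives every vertex of
-- its middle column reception at least 2.
--
-- Lower bound: let every broadcaster earn 2 and every column cost 1. A potential
-- on the last four columns rises by at most the balance of each new column
-- whenever the window that column completes is valid, starts no higher than the
-- earnings of the first two grid columns, and is at least 1 after the last
-- window. Telescoping over the n windows gives n + 1 ≤ 2|S|. These three
-- properties are finite statements about columns, decided by evaluation.
--
-- Upper bound: broadcasters alternately in the top and bottom row of every
-- other column, plus one in the middle of the last column when n is even.
-- Prepending four columns of this pattern leaves the windows further right
-- unchanged, and the five new leftmost windows do not depend on n.

module Submission where

open import Defs
open import Data.Bool using (Bool; true; false; _∧_; _∨_; T)
open import Data.Bool.Properties using (¬-not)
open import Data.Empty using (⊥-elim)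
open import Data.Fin using (Fin; toℕ; zero; suc; fromℕ)
open import Data.Fin.Patterns using (0F; 1F; 2F)
open import Data.Fin.Properties using (_≟_; all?; toℕ<n; toℕ-injective; toℕ-fromℕ; suc-injective)
open import Data.List using (List; []; _∷_; map; length)
open import Data.List.Properties using (map-∘; length-map)
open import Data.List.Relation.Unary.All as All using (All; []; _∷_)
import Data.List.Relation.Unary.All.Properties as All
open import Data.List.Relation.Unary.AllPairs using ([]; _∷_)
open import Data.List.Relation.Unary.Unique.Propositional using (Unique)
open import Data.List.Relation.Unary.Unique.Propositional.Properties using (map⁺)
open import Data.Maybe using (Maybe; just; nothing)
open import Data.Nat using (ℕ; zero; suc; _+_; _*_; _∸_; _≤_; _<ᵇ_; _≡ᵇ_; _≤ᵇ_; _≤?_; z≤n; s≤s; ⌈_/2⌉)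
open import Data.Nat.ListAction using (sum)
open import Data.Nat.Properties
  using ( +-identityʳ; +-assoc; +-comm; +-suc; +-cancelˡ-≡; +-monoˡ-≤; +-mono-≤; *-distribʳ-+; *-distribˡ-+
        ; *-monoʳ-≤; ≤-refl; ≤-trans; ≤-reflexive; ≮⇒≥; <⇒≢; <⇒<ᵇ; ≡ᵇ⇒≡; m≤n⇒m∸n≡0; m≤m+n; m≤n+m
        ; m<n⇒m<1+n; ⌈n/2⌉-mono; n≡⌈n+n/2⌉; +-*-semiring; module ≤-Reasoning)
open import Algebra.Properties.Semiring.Sum +-*-semiring
  using (sum-syntax; sum-cong-≗; ∑-distrib-+; sum-replicate-zero; *-distribˡ-sum)
open import Data.Product using (_×_; _,_; proj₁; proj₂)
open import Data.Vec using (Vec; []; _∷_)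
open import Data.Vec.Functional using (Vector)
open import Function using (_∘_)
open import Relation.Binary.PropositionalEquality
open import Relation.Nullary using (contradiction; yes; no)
open import Relation.Nullary.Decidable using (Dec; does; map′; toWitness; _×-dec_; _→-dec_)
open import Relation.Unary using (Decidable)

iverson : Bool → ℕ
iverson true = 1
iverson false = 0

-- Locality of reception

contrib≡∸ : ∀ {m n} t (u v : Vertex m n) → contrib t u v ≡ t ∸ dist u v
contrib≡∸ t u v with dist u v <ᵇ t in d<ᵇt
... | true = refl
... | false = sym (m≤n⇒m∸n≡0 (≮⇒≥ λ d<t → subst T d<ᵇt (<⇒<ᵇ {dist u v} {t} d<t)))

-- Slot d of a window is the column at offset d − 2 from its middle column.
strength : Fin 3 → Fin 3 → Fin 5 → ℕ
strength i r d = 3 ∸ (∣ toℕ i - toℕ r ∣ + ∣ toℕ d - 2 ∣)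

received : (Fin 5 → Fin 3 → ℕ) → Fin 3 → ℕ
received m i = ∑[ d < 5 ] ∑[ r < 3 ] (m d r * strength i r d)

∑∑-distrib-+ : ∀ {k l} (f g : Fin k → Fin l → ℕ) →
  ∑[ i < k ] ∑[ j < l ] (f i j + g i j) ≡ ∑[ i < k ] ∑[ j < l ] f i j + ∑[ i < k ] ∑[ j < l ] g i j
∑∑-distrib-+ {l = l} f g = trans (sum-cong-≗ λ i → ∑-distrib-+ (f i) (g i))
                                  (∑-distrib-+ (λ i → ∑[ j < l ] f i j) (λ i → ∑[ j < l ] g i j))

received-+ : ∀ m m' i → received (λ d r → m d r + m' d r) i ≡ received m i + received m' i
received-+ m m' i =
  trans (sum-cong-≗ λ d → sum-cong-≗ λ r → *-distribʳ-+ (strength i r d) (m d r) (m' d r))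
        (∑∑-distrib-+ (λ d r → m d r * strength i r d) (λ d r → m' d r * strength i r d))

received-cong : ∀ {m m'} → (∀ d r → m d r ≡ m' d r) → ∀ i → received m i ≡ received m' i
received-cong m≗m' i = sum-cong-≗ λ d → sum-cong-≗ λ r → cong (_* strength i r d) (m≗m' d r)

∑-row-collapse : ∀ (r' : Fin 3) b (g : Fin 3 → ℕ) →
  ∑[ r < 3 ] (iverson (b ∧ does (r' ≟ r)) * g r) ≡ iverson b * g r'
∑-row-collapse r' false g = refl
∑-row-collapse r'@zero true g = +-identityʳ (iverson true * g r')
∑-row-collapse r'@(suc zero) true g = +-identityʳ (iverson true * g r')
∑-row-collapse r'@(suc (suc zero)) true g = +-identityʳ (iverson true * g r')

+-identityʳ² : ∀ m → m + 0 + 0 ≡ m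
+-identityʳ² m = trans (+-identityʳ (m + 0)) (+-identityʳ m)

window-slot-sum : (g : ℕ → ℕ) → (∀ k → g (3 + k) ≡ 0) → ∀ x y →
  ∑[ d < 5 ] (iverson (2 + y ≡ᵇ toℕ d + x) * g ∣ toℕ d - 2 ∣) ≡ g ∣ x - y ∣
window-slot-sum g _ zero zero = +-identityʳ² (g 0)
window-slot-sum g _ zero (suc zero) = +-identityʳ² (g 1)
window-slot-sum g _ zero (suc (suc zero)) = +-identityʳ² (g 2)
window-slot-sum g far zero (suc (suc (suc k))) = sym (far k)
window-slot-sum g _ (suc zero) zero = +-identityʳ² (g 1)
window-slot-sum g _ (suc (suc zero)) zero = +-identityʳ² (g 2)
window-slot-sum g far (suc (suc (suc k))) zero = sym (far (k + 0))
window-slot-sum g far (suc x) (suc y) = window-slot-sum g far x y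

-- Column y of the grid gets index 2 + y, so that indices 0 and 1 are the padding on the left.
isAt : ∀ {n} → ℕ → Fin 3 → Vertex 3 n → Bool
isAt k r (r' , y) = (2 + toℕ y ≡ᵇ k) ∧ does (r' ≟ r)

occupancy : ∀ {n} → List (Vertex 3 n) → ℕ → Fin 3 → ℕ
occupancy S k r = sum (map (λ v → iverson (isAt k r v)) S)

contrib-as-received : ∀ {n} i (x : Fin n) v →
  contrib 3 (i , x) v ≡ received (λ d r → iverson (isAt (toℕ d + toℕ x) r v)) i
contrib-as-received i x (r' , y) = begin
  contrib 3 (i , x) (r' , y)
    ≡⟨ contrib≡∸ 3 (i , x) (r' , y) ⟩
  3 ∸ (e + ∣ toℕ x - toℕ y ∣)
    ≡⟨ window-slot-sum (λ k → 3 ∸ (e + k)) out-of-reach (toℕ x) (toℕ y) ⟨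
  ∑[ d < 5 ] (iverson (2 + toℕ y ≡ᵇ toℕ d + toℕ x) * strength i r' d)
    ≡⟨ sum-cong-≗ (λ d → ∑-row-collapse r' (2 + toℕ y ≡ᵇ toℕ d + toℕ x) (λ r → strength i r d)) ⟨
  received (λ d r → iverson (isAt (toℕ d + toℕ x) r (r' , y))) i ∎
  where
  open ≡-Reasoning
  e : ℕ
  e = ∣ toℕ i - toℕ r' ∣
  out-of-reach : ∀ k → 3 ∸ (e + (3 + k)) ≡ 0
  out-of-reach k = m≤n⇒m∸n≡0 (≤-trans (m≤m+n 3 k) (m≤n+m (3 + k) e))

reception-as-received : ∀ {n} (S : List (Vertex 3 n)) i x →
  reception 3 S (i , x) ≡ received (λ d r → occupancy S (toℕ d + toℕ x) r) i
reception-as-received [] i x = refl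
reception-as-received (v ∷ S) i x =
  trans (cong₂ _+_ (contrib-as-received i x v) (reception-as-received S i x))
        (sym (received-+ (λ d r → iverson (isAt (toℕ d + toℕ x) r v))
                         (λ d r → occupancy S (toℕ d + toℕ x) r) i))

record Column : Set where
  constructor column
  field
    top middle bottom : Bool

occupied : Column → Fin 3 → Bool
occupied c zero = Column.top c
occupied c (suc zero) = Column.middle c
occupied c (suc (suc zero)) = Column.bottom c

tabulateColumn : (Fin 3 → Bool) → Column
tabulateColumn f = column (f 0F) (f 1F) (f 2F)

occupied-tabulate : ∀ f r → occupied (tabulateColumn f) r ≡ f r
occupied-tabulate f zero = refl
occupied-tabulate f (suc zero) = refl
occupied-tabulate f (suc (suc zero)) = refl

∅ : Column
∅ = tabulateColumn λ _ → false

occupied-∅ : ∀ r → occupied ∅ r ≡ false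
occupied-∅ = occupied-tabulate λ _ → false

size : Column → ℕ
size c = ∑[ r < 3 ] iverson (occupied c r)

window : Column → Column → Column → Column → Column → Vector Column 5
window a b c d e zero = a
window a b c d e (suc zero) = b
window a b c d e (suc (suc zero)) = c
window a b c d e (suc (suc (suc zero))) = d
window a b c d e (suc (suc (suc (suc zero)))) = e

windowAt : (ℕ → Column) → ℕ → Vector Column 5
windowAt c x d = c (toℕ d + x)

windowReception : Vector Column 5 → Fin 3 → ℕ
windowReception w = received λ d r → iverson (occupied (w d) r)

ValidWindow : Vector Column 5 → Set
ValidWindow w = ∀ i → 2 ≤ windowReception w i

validWindow? : Decidable ValidWindow
validWindow? w = all? λ i → 2 ≤? windowReception w i

AllWindowsValid : (ℕ → Column) → ℕ → Set
AllWindowsValid c n = ∀ (x : Fin n) → ValidWindow (windowAt c (toℕ x))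

allWindowsValid? : ∀ c n → Dec (AllWindowsValid c n)
allWindowsValid? c n = all? λ x → validWindow? (windowAt c (toℕ x))

Describes : ∀ {n} → List (Vertex 3 n) → (ℕ → Column) → Set
Describes S c = ∀ k r → occupancy S k r ≡ iverson (occupied (c k) r)

reception-window : ∀ {n} (S : List (Vertex 3 n)) {c} → Describes S c → ∀ i x →
  reception 3 S (i , x) ≡ windowReception (windowAt c (toℕ x)) i
reception-window S S≈c i x =
  trans (reception-as-received S i x) (received-cong (λ d r → S≈c (toℕ d + toℕ x) r) i)

occupancy-outside : ∀ {n} (S : List (Vertex 3 n)) k → (∀ (y : Fin n) → (2 + toℕ y ≡ᵇ k) ≡ false) →
  ∀ r → occupancy S k r ≡ 0
occupancy-outside [] k away r = refl
occupancy-outside ((r' , y) ∷ S) k away r rewrite away y = occupancy-outside S k away r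

≢⇒≡ᵇ-false : ∀ {m n} → m ≢ n → (m ≡ᵇ n) ≡ false
≢⇒≡ᵇ-false {m} {n} m≢n = ¬-not λ m≡ᵇn → m≢n (≡ᵇ⇒≡ m n (subst T (sym m≡ᵇn) _))

unique-sum-iverson≤1 : ∀ {A : Set} (p : A → Bool) → (∀ {v w} → T (p v) → T (p w) → v ≡ w) →
  ∀ {S} → Unique S → sum (map (iverson ∘ p) S) ≤ 1
unique-sum-iverson≤1 p p-injective [] = z≤n
unique-sum-iverson≤1 p p-injective {v ∷ S} (v∉S ∷ S-unique) with p v in pv
... | false = unique-sum-iverson≤1 p p-injective S-unique
... | true = s≤s (≤-reflexive (none S v∉S))
  where
  none : ∀ S → All (v ≢_) S → sum (map (iverson ∘ p) S) ≡ 0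
  none [] [] = refl
  none (w ∷ S) (v≢w ∷ v∉S) with p w in pw
  ... | false = none S v∉S
  ... | true = contradiction (p-injective (subst T (sym pv) _) (subst T (sym pw) _)) v≢w

isAt-sound : ∀ {n k r} (v : Vertex 3 n) → T (isAt k r v) → proj₁ v ≡ r × 2 + toℕ (proj₂ v) ≡ k
isAt-sound {k = k} {r} (r' , y) at with 2 + toℕ y ≡ᵇ k in column-k | r' ≟ r
... | true | yes r'≡r = r'≡r , ≡ᵇ⇒≡ (2 + toℕ y) k (subst T (sym column-k) _)
... | true | no _ = ⊥-elim at
... | false | _ = ⊥-elim at

isAt-injective : ∀ {n} k r {v w : Vertex 3 n} → T (isAt k r v) → T (isAt k r w) → v ≡ w
isAt-injective k r {v} {w} at-v at-w with isAt-sound {k = k} {r} v at-v | isAt-sound {k = k} {r} w at-w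
... | row-v , column-v | row-w , column-w =
  cong₂ _,_ (trans row-v (sym row-w)) (toℕ-injective (+-cancelˡ-≡ 2 _ _ (trans column-v (sym column-w))))

iverson-0<ᵇ : ∀ {m} → m ≤ 1 → iverson (0 <ᵇ m) ≡ m
iverson-0<ᵇ {zero} _ = refl
iverson-0<ᵇ {suc zero} _ = refl
iverson-0<ᵇ {suc (suc _)} (s≤s ())

columnsOf : ∀ {n} → List (Vertex 3 n) → ℕ → Column
columnsOf S k = tabulateColumn λ r → 0 <ᵇ occupancy S k r

describes-columnsOf : ∀ {n} (S : List (Vertex 3 n)) → Unique S → Describes S (columnsOf S)
describes-columnsOf S S-unique k r = begin
  occupancy S k r
    ≡⟨ iverson-0<ᵇ (unique-sum-iverson≤1 (isAt k r) (isAt-injective k r) S-unique) ⟨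
  iverson (0 <ᵇ occupancy S k r)
    ≡⟨ cong iverson (occupied-tabulate (λ r → 0 <ᵇ occupancy S k r) r) ⟨
  iverson (occupied (columnsOf S k) r) ∎
  where open ≡-Reasoning

columnsOf-outside : ∀ {n} (S : List (Vertex 3 n)) k → (∀ (y : Fin n) → (2 + toℕ y ≡ᵇ k) ≡ false) →
  columnsOf S k ≡ ∅
columnsOf-outside S k away
  rewrite occupancy-outside S k away 0F
        | occupancy-outside S k away 1F
        | occupancy-outside S k away 2F = refl

∑-row-count : ∀ (r' : Fin 3) b → ∑[ r < 3 ] iverson (b ∧ does (r' ≟ r)) ≡ iverson b
∑-row-count r' false = refl
∑-row-count zero true = refl
∑-row-count (suc zero) true = refl
∑-row-count (suc (suc zero)) true = refl

∑-iverson-≡ᵇ≤1 : ∀ m N → ∑[ k < N ] iverson (m ≡ᵇ toℕ k) ≤ 1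
∑-iverson-≡ᵇ≤1 m zero = z≤n
∑-iverson-≡ᵇ≤1 zero (suc N) = s≤s (≤-reflexive (sum-replicate-zero N))
∑-iverson-≡ᵇ≤1 (suc m) (suc N) = ∑-iverson-≡ᵇ≤1 m N

vertex-occupancy≤1 : ∀ {n} (v : Vertex 3 n) N → ∑[ k < N ] ∑[ r < 3 ] iverson (isAt (toℕ k) r v) ≤ 1
vertex-occupancy≤1 (r' , y) N =
  ≤-trans (≤-reflexive (sum-cong-≗ {N} λ k → ∑-row-count r' (2 + toℕ y ≡ᵇ toℕ k)))
          (∑-iverson-≡ᵇ≤1 (2 + toℕ y) N)

total-occupancy≤length : ∀ {n} N (S : List (Vertex 3 n)) →
  ∑[ k < N ] ∑[ r < 3 ] occupancy S (toℕ k) r ≤ length S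
total-occupancy≤length N [] = ≤-reflexive (sum-replicate-zero N)
total-occupancy≤length N (v ∷ S) = begin
  ∑[ k < N ] ∑[ r < 3 ] (iverson (isAt (toℕ k) r v) + occupancy S (toℕ k) r)
    ≡⟨ ∑∑-distrib-+ {N} (λ k r → iverson (isAt (toℕ k) r v)) (λ k r → occupancy S (toℕ k) r) ⟩
  ∑[ k < N ] ∑[ r < 3 ] iverson (isAt (toℕ k) r v) + ∑[ k < N ] ∑[ r < 3 ] occupancy S (toℕ k) r
    ≤⟨ +-mono-≤ (vertex-occupancy≤1 v N) (total-occupancy≤length N S) ⟩
  1 + length S ∎
  where open ≤-Reasoning

describes-size≤length : ∀ {n} (S : List (Vertex 3 n)) {c} → Describes S c →
  ∀ N → ∑[ k < N ] size (c (toℕ k)) ≤ length S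
describes-size≤length S {c} S≈c N = begin
  ∑[ k < N ] size (c (toℕ k))
    ≡⟨ sum-cong-≗ {N} (λ k → sum-cong-≗ {x = occupancy S (toℕ k)} {y = λ r → iverson (occupied (c (toℕ k)) r)}
                                       (S≈c (toℕ k))) ⟨
  ∑[ k < N ] ∑[ r < 3 ] occupancy S (toℕ k) r
    ≤⟨ total-occupancy≤length N S ⟩
  length S ∎
  where open ≤-Reasoning

-- The potential argument

∀-bool? : ∀ {P : Bool → Set} → Decidable P → Dec (∀ b → P b)
∀-bool? P? = map′ (λ { (t , f) true → t ; (t , f) false → f }) (λ g → g true , g false) (P? true ×-dec P? false)

∀-column? : ∀ {P : Column → Set} → Decidable P → Dec (∀ c → P c)
∀-column? P? = map′ (λ h c → h (Column.top c) (Column.middle c) (Column.bottom c)) (λ h a b c → h (column a b c))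
  (∀-bool? λ a → ∀-bool? λ b → ∀-bool? λ c → P? (column a b c))

-- A column costs 1 and each of its broadcasters pays 2; a surplus is not carried forward.
payDebt : ℕ → Column → ℕ
payDebt D c = suc D ∸ 2 * size c

debt : Column → Column → Column → Column → ℕ
debt a b c d = payDebt (payDebt (payDebt (payDebt 0 a) b) c) d

-- The states of the zigzag placement below, where the accounting is tight.
sparseZigzag : Column → Column → Column → Column → Bool
sparseZigzag a b c d = ((size a ≡ᵇ 0) ∧ (size b ≡ᵇ 1) ∧ (size c ≡ᵇ 0) ∧ (size d ≤ᵇ 1))
                     ∨ ((size a ≡ᵇ 1) ∧ (size b ≡ᵇ 0) ∧ (size c ≡ᵇ 1) ∧ (size d ≡ᵇ 0))

potential : Column → Column → Column → Column → ℕ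
potential a b c d = 4 ∸ (debt a b c d + iverson (sparseZigzag a b c d))

potential-init : ∀ c d → potential ∅ ∅ c d ≤ 2 * (size c + size d)
potential-init = toWitness {a? = ∀-column? λ c → ∀-column? λ d →
  potential ∅ ∅ c d ≤? 2 * (size c + size d)} _

potential-step : ∀ a b c d e → ValidWindow (window a b c d e) →
  potential b c d e + 1 ≤ potential a b c d + 2 * size e
potential-step = toWitness {a? =
  ∀-column? λ a → ∀-column? λ b → ∀-column? λ c → ∀-column? λ d → ∀-column? λ e →
  validWindow? (window a b c d e) →-dec (potential b c d e + 1 ≤? potential a b c d + 2 * size e)} _

potential-final : ∀ a b c → ValidWindow (window a b c ∅ ∅) → 1 ≤ potential b c ∅ ∅
potential-final = toWitness {a? = ∀-column? λ a → ∀-column? λ b → ∀-column? λ c →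
  validWindow? (window a b c ∅ ∅) →-dec (1 ≤? potential b c ∅ ∅)} _

telescope : (Φ g : ℕ → ℕ) (n : ℕ) → (∀ (x : Fin n) → Φ (suc (toℕ x)) + 1 ≤ Φ (toℕ x) + g (toℕ x)) →
  Φ n + n ≤ Φ 0 + ∑[ x < n ] g (toℕ x)
telescope Φ g zero _ = ≤-refl
telescope Φ g (suc n) step = begin
  Φ (suc n) + suc n    ≡⟨ +-suc (Φ (suc n)) n ⟩
  suc (Φ (suc n) + n)  ≤⟨ s≤s (telescope (Φ ∘ suc) (g ∘ suc) n (step ∘ suc)) ⟩
  suc (Φ 1 + G)        ≡⟨ cong (_+ G) (+-comm 1 (Φ 1)) ⟩
  Φ 1 + 1 + G          ≤⟨ +-monoˡ-≤ G (step zero) ⟩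
  Φ 0 + g 0 + G        ≡⟨ +-assoc (Φ 0) (g 0) G ⟩
  Φ 0 + (g 0 + G)      ∎
  where
  open ≤-Reasoning
  G : ℕ
  G = ∑[ x < n ] g (suc (toℕ x))

columns-lower-bound : (c : ℕ → Column) (n : ℕ) → 1 ≤ n →
  c 0 ≡ ∅ → c 1 ≡ ∅ → c (2 + n) ≡ ∅ → c (3 + n) ≡ ∅ → AllWindowsValid c n →
  n + 1 ≤ 2 * ∑[ k < 4 + n ] size (c (toℕ k))
columns-lower-bound c n@(suc m) _ c₀ c₁ c₂₊ₙ c₃₊ₙ valid = begin
  n + 1                                          ≡⟨ +-comm n 1 ⟩
  1 + n                                          ≤⟨ +-monoˡ-≤ n last-potential ⟩
  Φ n + n                                        ≤⟨ telescope Φ g n step ⟩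
  Φ 0 + ∑[ x < n ] g (toℕ x)                      ≤⟨ +-monoˡ-≤ _ first-potential ⟩
  2 * (size (c 2) + size (c 3)) + ∑[ x < n ] g (toℕ x)
                                                 ≡⟨ cong (2 * (size (c 2) + size (c 3)) +_) (*-distribˡ-sum 2 F) ⟨
  2 * (size (c 2) + size (c 3)) + 2 * ∑[ x < n ] F x
                                                 ≡⟨ *-distribˡ-+ 2 (size (c 2) + size (c 3)) (∑[ x < n ] F x) ⟨
  2 * (size (c 2) + size (c 3) + ∑[ x < n ] F x)  ≡⟨ cong (2 *_) padded-total ⟨
  2 * ∑[ k < 4 + n ] size (c (toℕ k))            ∎
  where
  open ≤-Reasoning
  Φ : ℕ → ℕ
  Φ x = potential (c x) (c (1 + x)) (c (2 + x)) (c (3 + x))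
  F : Vector ℕ n
  F x = size (c (4 + toℕ x))
  g : ℕ → ℕ
  g x = 2 * size (c (4 + x))
  step : ∀ (x : Fin n) → Φ (suc (toℕ x)) + 1 ≤ Φ (toℕ x) + g (toℕ x)
  step x = let y = toℕ x in potential-step (c y) (c (1 + y)) (c (2 + y)) (c (3 + y)) (c (4 + y)) (valid x)
  first-potential : Φ 0 ≤ 2 * (size (c 2) + size (c 3))
  first-potential = subst₂ (λ a b → potential a b (c 2) (c 3) ≤ 2 * (size (c 2) + size (c 3))) (sym c₀) (sym c₁)
    (potential-init (c 2) (c 3))
  last-window : ValidWindow (window (c m) (c n) (c (1 + n)) ∅ ∅)
  last-window = subst₂ (λ d e → ValidWindow (window (c m) (c n) (c (1 + n)) d e)) c₂₊ₙ c₃₊ₙ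
    (subst (ValidWindow ∘ windowAt c) (toℕ-fromℕ m) (valid (fromℕ m)))
  last-potential : 1 ≤ Φ n
  last-potential = subst₂ (λ d e → 1 ≤ potential (c n) (c (1 + n)) d e) (sym c₂₊ₙ) (sym c₃₊ₙ)
    (potential-final (c m) (c n) (c (1 + n)) last-window)
  padded-total : ∑[ k < 4 + n ] size (c (toℕ k)) ≡ size (c 2) + size (c 3) + ∑[ x < n ] F x
  padded-total rewrite c₀ | c₁ = sym (+-assoc (size (c 2)) (size (c 3)) (∑[ x < n ] F x))

broadcast-lower-bound : ∀ {n} → 1 ≤ n → (S : List (Vertex 3 n)) → IsBroadcastDominating 3 2 S →
  n + 1 ≤ 2 * length S
broadcast-lower-bound {n} 1≤n S (S-unique , S-dominating) = begin
  n + 1                                          ≤⟨ columns-lower-bound (columnsOf S) n 1≤n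
                                                      (outside 0 λ _ → refl) (outside 1 λ _ → refl)
                                                      (outside (2 + n) λ y → ≢⇒≡ᵇ-false (<⇒≢ (toℕ<n y)))
                                                      (outside (3 + n) λ y → ≢⇒≡ᵇ-false (<⇒≢ (m<n⇒m<1+n (toℕ<n y))))
                                                      valid ⟩
  2 * ∑[ k < 4 + n ] size (columnsOf S (toℕ k))  ≤⟨ *-monoʳ-≤ 2 (describes-size≤length S S≈c (4 + n)) ⟩
  2 * length S                                   ∎
  where
  open ≤-Reasoning
  outside : ∀ k → (∀ (y : Fin n) → (2 + toℕ y ≡ᵇ k) ≡ false) → columnsOf S k ≡ ∅
  outside = columnsOf-outside S
  S≈c : Describes S (columnsOf S)
  S≈c = describes-columnsOf S S-unique
  valid : AllWindowsValid (columnsOf S) n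
  valid x i = subst (2 ≤_) (reception-window S S≈c i x) (S-dominating (i , x))

⌈/2⌉-≤ : ∀ {m k} → m ≤ 2 * k → ⌈ m /2⌉ ≤ k
⌈/2⌉-≤ {m} {k} m≤2k = begin
  ⌈ m /2⌉           ≤⟨ ⌈n/2⌉-mono m≤2k ⟩
  ⌈ k + (k + 0) /2⌉ ≡⟨ cong (λ j → ⌈ k + j /2⌉) (+-identityʳ k) ⟩
  ⌈ k + k /2⌉       ≡⟨ n≡⌈n+n/2⌉ k ⟨
  k                 ∎
  where open ≤-Reasoning

-- The zigzag placement

shift : ∀ {n} → Vertex 3 n → Vertex 3 (suc n)
shift (r , y) = r , suc y

shift-injective : ∀ {n} {v w : Vertex 3 n} → shift v ≡ shift w → v ≡ w
shift-injective eq = cong₂ _,_ (cong proj₁ eq) (suc-injective (cong proj₂ eq))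

-- A word lists, column by column, the row of the column's broadcaster, if any.
placement : ∀ {n} → Vec (Maybe (Fin 3)) n → List (Vertex 3 n)
placement [] = []
placement (nothing ∷ w) = map shift (placement w)
placement (just r ∷ w) = (r , zero) ∷ map shift (placement w)

broadcasters : ∀ {n} → Vec (Maybe (Fin 3)) n → ℕ
broadcasters [] = 0
broadcasters (nothing ∷ w) = broadcasters w
broadcasters (just _ ∷ w) = suc (broadcasters w)

cellColumn : Maybe (Fin 3) → Column
cellColumn nothing = ∅
cellColumn (just r) = tabulateColumn λ r' → does (r ≟ r')

columnAt : ∀ {n} → Vec (Maybe (Fin 3)) n → ℕ → Column
columnAt [] _ = ∅
columnAt (cell ∷ w) zero = cellColumn cell
columnAt (cell ∷ w) (suc y) = columnAt w y

columnsOfWord : ∀ {n} → Vec (Maybe (Fin 3)) n → ℕ → Column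
columnsOfWord w (suc (suc y)) = columnAt w y
columnsOfWord w _ = ∅

occupancy-shift : ∀ {n} (S : List (Vertex 3 n)) k r → occupancy (map shift S) (suc k) r ≡ occupancy S k r
occupancy-shift S k r = cong sum (sym (map-∘ {g = λ v → iverson (isAt (suc k) r v)} {f = shift} S))

occupancy-columnAt : ∀ {n} (w : Vec (Maybe (Fin 3)) n) y r →
  occupancy (placement w) (2 + y) r ≡ iverson (occupied (columnAt w y) r)
occupancy-columnAt [] y r = cong iverson (sym (occupied-∅ r))
occupancy-columnAt (nothing ∷ w) zero r = begin
  occupancy (map shift (placement w)) 2 r   ≡⟨ occupancy-shift (placement w) 1 r ⟩
  occupancy (placement w) 1 r               ≡⟨ occupancy-outside (placement w) 1 (λ _ → refl) r ⟩
  0                                         ≡⟨ cong iverson (occupied-∅ r) ⟨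
  iverson (occupied ∅ r)                    ∎
  where open ≡-Reasoning
occupancy-columnAt (just r' ∷ w) zero r = begin
  iverson (does (r' ≟ r)) + occupancy (map shift (placement w)) 2 r
    ≡⟨ cong (iverson (does (r' ≟ r)) +_) (occupancy-shift (placement w) 1 r) ⟩
  iverson (does (r' ≟ r)) + occupancy (placement w) 1 r
    ≡⟨ cong (iverson (does (r' ≟ r)) +_) (occupancy-outside (placement w) 1 (λ _ → refl) r) ⟩
  iverson (does (r' ≟ r)) + 0
    ≡⟨ +-identityʳ _ ⟩
  iverson (does (r' ≟ r))
    ≡⟨ cong iverson (occupied-tabulate (λ r'' → does (r' ≟ r'')) r) ⟨
  iverson (occupied (cellColumn (just r')) r) ∎
  where open ≡-Reasoning
occupancy-columnAt (nothing ∷ w) (suc y) r = trans (occupancy-shift (placement w) (2 + y) r) (occupancy-columnAt w y r)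
occupancy-columnAt (just _ ∷ w) (suc y) r = trans (occupancy-shift (placement w) (2 + y) r) (occupancy-columnAt w y r)

describes-placement : ∀ {n} (w : Vec (Maybe (Fin 3)) n) → Describes (placement w) (columnsOfWord w)
describes-placement w zero r =
  trans (occupancy-outside (placement w) 0 (λ _ → refl) r) (cong iverson (sym (occupied-∅ r)))
describes-placement w (suc zero) r =
  trans (occupancy-outside (placement w) 1 (λ _ → refl) r) (cong iverson (sym (occupied-∅ r)))
describes-placement w (suc (suc y)) r = occupancy-columnAt w y r

placement-unique : ∀ {n} (w : Vec (Maybe (Fin 3)) n) → Unique (placement w)
placement-unique [] = []
placement-unique (nothing ∷ w) = map⁺ shift-injective (placement-unique w)
placement-unique (just r ∷ w) =
  All.map⁺ (All.universal (λ _ ()) (placement w)) ∷ map⁺ shift-injective (placement-unique w)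

length-placement : ∀ {n} (w : Vec (Maybe (Fin 3)) n) → length (placement w) ≡ broadcasters w
length-placement [] = refl
length-placement (nothing ∷ w) = trans (length-map shift (placement w)) (length-placement w)
length-placement (just _ ∷ w) = cong suc (trans (length-map shift (placement w)) (length-placement w))

zigzagTail : (m : ℕ) → Vec (Maybe (Fin 3)) m
zigzagTail 0 = []
zigzagTail 1 = just 1F ∷ []
zigzagTail 2 = nothing ∷ just 0F ∷ []
zigzagTail 3 = nothing ∷ just 0F ∷ just 1F ∷ []
zigzagTail (suc (suc (suc (suc m)))) = nothing ∷ just 0F ∷ nothing ∷ just 2F ∷ zigzagTail m

zigzag : (m : ℕ) → Vec (Maybe (Fin 3)) (3 + m)
zigzag m = just 0F ∷ nothing ∷ just 2F ∷ zigzagTail m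

zigzag-size : ∀ m → broadcasters (zigzag m) ≡ ⌈ 3 + m + 1 /2⌉
zigzag-size 0 = refl
zigzag-size 1 = refl
zigzag-size 2 = refl
zigzag-size 3 = refl
zigzag-size (suc (suc (suc (suc m)))) = cong (2 +_) (zigzag-size m)

zigzag-valid : ∀ m → AllWindowsValid (columnsOfWord (zigzag m)) (3 + m)
zigzag-valid 0 = toWitness {a? = allWindowsValid? (columnsOfWord (zigzag 0)) 3} _
zigzag-valid 1 = toWitness {a? = allWindowsValid? (columnsOfWord (zigzag 1)) 4} _
zigzag-valid 2 = toWitness {a? = allWindowsValid? (columnsOfWord (zigzag 2)) 5} _
zigzag-valid 3 = toWitness {a? = allWindowsValid? (columnsOfWord (zigzag 3)) 6} _
zigzag-valid (suc (suc (suc (suc m)))) = valid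
  where
  leading : AllWindowsValid (columnsOfWord (zigzag (4 + m))) 5
  leading = toWitness {a? = allWindowsValid? (columnsOfWord (zigzag (4 + m))) 5} _
  valid : AllWindowsValid (columnsOfWord (zigzag (4 + m))) (7 + m)
  valid zero = leading 0F
  valid (suc zero) = leading 1F
  valid (suc (suc zero)) = leading 2F
  valid (suc (suc (suc zero))) = leading (suc 2F)
  valid (suc (suc (suc (suc zero)))) = leading (suc (suc 2F))
  valid (suc (suc (suc (suc (suc zero))))) = zigzag-valid m 1F   -- the fourth new column is empty, like the padding
  valid (suc (suc (suc (suc (suc (suc x)))))) = zigzag-valid m (suc (suc x))

zigzag-dominating : ∀ m → IsBroadcastDominating 3 2 (placement (zigzag m))
zigzag-dominating m = placement-unique (zigzag m) , λ (i , x) →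
  subst (2 ≤_) (sym (reception-window (placement (zigzag m)) (describes-placement (zigzag m)) i x)) (zigzag-valid m x i)

mainTheorem6 : (n : ℕ) → 3 ≤ n →
    BroadcastDominationNumber 3 2 3 n ⌈ n + 1 /2⌉
mainTheorem6 _ (s≤s (s≤s (s≤s {n = m} z≤n))) =
  (placement (zigzag m) , zigzag-dominating m , trans (length-placement (zigzag m)) (zigzag-size m)) ,
  λ S S-dominating → ⌈/2⌉-≤ (broadcast-lower-bound (s≤s z≤n) S S-dominating)
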